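{- Let $\lambda\vdash n$ with $\lambda'=(s,r)$, $s\ge r\ge1$. Then: (i) If $\pi$ is a minimal permutation of shape $\lambda$ and $J_1\neq J_2$ are jump partitions for $\pi$, each of size less than $r$ and each valid for $\pi$, then $J_1(\pi)\neq J_2(\pi)$. (ii) If $\pi_1\neq\pi_2$ are minimal permutations of shape $\lambda$, and $J_1$ (resp. $J_2$) is a jump partition of size less than $r$ valid for $\pi_1$ (resp. $\pi_2$), then $J_1(\pi_1)\neq J_2(\pi_2)$.
   Context: Shape means Robinson–Schensted shape; $\lambda'$ is the conjugate of $\lambda$. A minimal permutation of shape $\lambda$ is a permutation of shape $\lambda$ with the fewest inversions; for $\lambda'=(s,r)$ these are exactly $(c_1,c_1-1,\dots,1,\,n,\dots,c_1+1)$ (one-line notation) with $(c_1,c_2)\in\{(s,r),(r,s)\}$, $n=s+r$. For such $\pi$: $s_t$ is the adjacent transposition $(t\ t{+}1)$; $\sigma\cdot s_t$ swaps the entries at positions $t,t+1$ of $\sigma$, and $s_t\cdot\sigma$ swaps the values $t,t+1$; products act successively (left to right for right multiplication, rightmost first for left multiplication). An inner (resp. outer) jump partition is an integer partition $\mu$ (resp. $\nu$), possibly empty, with $\ell(\mu)\le c_1$, $\mu_1<c_2$ (resp. $\ell(\nu)\le c_1$, $\nu_1<c_2$). Actions: $\pi\circ\mu=\pi\cdot\prod_{j=1}^{\ell(\mu)}(s_{c_1-j+1}s_{c_1-j+2}\cdots s_{c_1-j+\mu_j})$ (factors in order $j=1,2,\dots$ left to right), and $\nu\circ\pi=F_{\ell(\nu)}\cdots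 F_1\cdot\pi$ with $F_j=s_{c_1-j+\nu_j}\cdots s_{c_1-j+2}s_{c_1-j+1}$. A jump partition is a pair $J=(\mu,\nu)$ of size $|\mu|+|\nu|$, with $J(\pi)=\nu\circ(\pi\circ\mu)$; it is valid for $\pi$ if the shape of $J(\pi)$ equals the shape of $\pi$. -}

module Defs where

open import Data.Nat using (ℕ; zero; suc; _+_; _∸_; _≤_; _<_; _<ᵇ_; _≡ᵇ_)
open import Data.Bool using (Bool; true; false; if_then_else_)
open import Data.List using (List; []; _∷_; _++_; map; length; foldl; downFrom; upTo)
open import Data.Nat.ListAction using (sum)
open import Data.List.Relation.Unary.All using (All)
open import Data.Maybe using (Maybe; just; nothing)
open import Data.Product using (_×_; _,_; proj₁; proj₂)
open import Data.Sum using (_⊎_)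
open import Data.Unit using (⊤)
open import Relation.Binary.PropositionalEquality using (_≡_)

-- Permutations of [n] in one-line notation, as lists of values 1..n.
Perm : Set
Perm = List ℕ

insertRow : ℕ → List ℕ → List ℕ × Maybe ℕ
insertRow x [] = (x ∷ [] , nothing)
insertRow x (y ∷ ys) with x <ᵇ y
... | true  = (x ∷ ys , just y)
... | false with insertRow x ys
...   | (row , b) = (y ∷ row , b)

Tableau : Set
Tableau = List (List ℕ)

insertT : ℕ → Tableau → Tableau
insertT x [] = (x ∷ []) ∷ []
insertT x (row ∷ rows) with insertRow x row
... | (row' , nothing) = row' ∷ rows
... | (row' , just y)  = row' ∷ insertT y rows

RS-P : Perm → Tableau
RS-P σ = foldl (λ T x → insertT x T) [] σ

shape : Perm → List ℕ
shape σ = map length (RS-P σ)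

-- σ · s_t : swap entries at positions t, t+1
swapPos : ℕ → Perm → Perm
swapPos _ [] = []
swapPos _ (x ∷ []) = x ∷ []
swapPos (suc zero) (x ∷ y ∷ zs) = y ∷ x ∷ zs
swapPos zero (x ∷ xs) = x ∷ xs          -- s_0 does not occur
swapPos (suc (suc t)) (x ∷ xs) = x ∷ swapPos (suc t) xs

-- s_t · σ : swap values t, t+1
swapValue : ℕ → ℕ → ℕ
swapValue t v = if v ≡ᵇ t then suc t else (if v ≡ᵇ suc t then t else v)

swapVal : ℕ → Perm → Perm
swapVal t σ = map (swapValue t) σ

-- Minimal permutations for λ' = (s,r):  (c1, c1-1, ..., 1, n, ..., c1+1)

minPerm : ℕ → ℕ → Perm
minPerm c₁ c₂ = map suc (downFrom c₁) ++ map (λ i → c₁ + suc i) (downFrom c₂)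

MinChoice : ℕ → ℕ → ℕ → ℕ → Set
MinChoice s r c₁ c₂ = (c₁ ≡ s × c₂ ≡ r) ⊎ (c₁ ≡ r × c₂ ≡ s)

data IsPartition : List ℕ → Set where
  []  : IsPartition []
  [_] : ∀ {x} → 1 ≤ x → IsPartition (x ∷ [])
  _∷_ : ∀ {x y ys} → y ≤ x → IsPartition (y ∷ ys) → IsPartition (x ∷ y ∷ ys)

HeadLt : ℕ → List ℕ → Set
HeadLt c [] = ⊤
HeadLt c (x ∷ _) = x < c

IsJumpPart : ℕ → ℕ → List ℕ → Set
IsJumpPart c₁ c₂ μ = IsPartition μ × length μ ≤ c₁ × HeadLt c₂ μ

JumpPartition : Set
JumpPartition = List ℕ × List ℕ

IsJump : ℕ → ℕ → JumpPartition → Set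
IsJump c₁ c₂ (μ , ν) = IsJumpPart c₁ c₂ μ × IsJumpPart c₁ c₂ ν

size : JumpPartition → ℕ
size (μ , ν) = sum μ + sum ν

-- row j (1-based) of length m: apply s_{c1-j+1}, ..., s_{c1-j+m} in this order
-- to positions (right multiplication, left to right)
innerRow : ℕ → ℕ → ℕ → Perm → Perm
innerRow c₁ j m σ = foldl (λ τ k → swapPos ((c₁ ∸ j) + suc k) τ) σ (upTo m)

innerAux : ℕ → ℕ → List ℕ → Perm → Perm
innerAux c₁ j [] σ = σ
innerAux c₁ j (m ∷ ms) σ = innerAux c₁ (suc j) ms (innerRow c₁ j m σ)

innerAct : ℕ → Perm → List ℕ → Perm
innerAct c₁ π μ = innerAux c₁ 1 μ π

-- F_j = s_{c1-j+m} ⋯ s_{c1-j+1} acting on the left: s_{c1-j+1} applied first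
outerRow : ℕ → ℕ → ℕ → Perm → Perm
outerRow c₁ j m σ = foldl (λ τ k → swapVal ((c₁ ∸ j) + suc k) τ) σ (upTo m)

outerAux : ℕ → ℕ → List ℕ → Perm → Perm
outerAux c₁ j [] σ = σ
outerAux c₁ j (m ∷ ms) σ = outerAux c₁ (suc j) ms (outerRow c₁ j m σ)

outerAct : ℕ → List ℕ → Perm → Perm
outerAct c₁ ν π = outerAux c₁ 1 ν π

applyJ : ℕ → JumpPartition → Perm → Perm
applyJ c₁ (μ , ν) π = outerAct c₁ ν (innerAct c₁ π μ)

Valid : ℕ → JumpPartition → Perm → Set
Valid c₁ J π = shape (applyJ c₁ J π) ≡ shape π

-- Write c₁ = a + 1 and let π be the minimal permutation. A jump partition (μ, ν)
-- of size below r ≤ c₁ has ℓ(μ) + ℓ(ν) ≤ a, and then J(π) is explicit along the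
-- diagonal of the first block: for i + ℓ(ν) ≤ a the value i + 1 sits at position
-- a + 1 - i + μᵢ, and for i + ℓ(μ) ≤ a position i + 1 holds a + 1 - i + νᵢ
-- (parts indexed from 0, μᵢ = 0 past the end). Hence J(π) determines μ and ν,
-- which is (i). For (ii) take c₁ = s > r = d₁. Since the four lengths sum to at
-- most 2(s - 1), either ℓ(μ₂) + ℓ(ν₁) ≤ s - 1, and then the value ℓ(μ₂) + 1 sits
-- strictly further right in J₁(π₁) than in J₂(π₂), or ℓ(ν₂) + ℓ(μ₁) ≤ s - 1, and
-- then position ℓ(ν₂) + 1 holds a strictly larger entry in J₁(π₁).
module Submission where

open import Defs
open import Data.Bool using (true; false)
open import Data.Empty using (⊥; ⊥-elim)
open import Data.List using (List; []; _∷_; _++_; _∷ʳ_; map; length; foldl; downFrom; upTo)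
open import Data.List.Properties using (foldl-∷ʳ; upTo-∷ʳ; map-id; map-∘; length-map; length-downFrom; length-++)
open import Data.List.Relation.Unary.All as All using (All; []; _∷_)
open import Data.Nat using (ℕ; zero; suc; _+_; _∸_; _≤_; _<_; _≡ᵇ_; _<?_; _≤?_; z≤n; s≤s; pred)
open import Data.Nat.ListAction using (sum)
open import Data.Nat.Properties
open import Data.Nat.Tactic.RingSolver using (solve-∀)
open import Data.Product using (_×_; _,_)
open import Data.Sum using (_⊎_; inj₁; inj₂; [_,_]′)
open import Function using (_∘_)
open import Relation.Binary.PropositionalEquality
open import Relation.Nullary using (yes; no)

swapValue-suc : ∀ t v → swapValue (suc t) (suc v) ≡ suc (swapValue t v)
swapValue-suc t v with v ≡ᵇ t
... | true = refl
... | false with v ≡ᵇ suc t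
...   | true = refl
...   | false = refl

swapValue-involutive : ∀ t v → swapValue t (swapValue t v) ≡ v
swapValue-involutive zero zero = refl
swapValue-involutive zero (suc zero) = refl
swapValue-involutive zero (suc (suc v)) = refl
swapValue-involutive (suc t) zero = refl
swapValue-involutive (suc t) (suc v) = begin
  swapValue (suc t) (swapValue (suc t) (suc v)) ≡⟨ cong (swapValue (suc t)) (swapValue-suc t v) ⟩
  swapValue (suc t) (suc (swapValue t v))       ≡⟨ swapValue-suc t (swapValue t v) ⟩
  suc (swapValue t (swapValue t v))             ≡⟨ cong suc (swapValue-involutive t v) ⟩
  suc v                                         ∎
  where open ≡-Reasoning

swapValue-same : ∀ t → swapValue t t ≡ suc t
swapValue-same zero = refl
swapValue-same (suc t) = trans (swapValue-suc t t) (cong suc (swapValue-same t))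

swapValue-fixes-< : ∀ {t v} → v < t → swapValue t v ≡ v
swapValue-fixes-< {suc t} {zero} _ = refl
swapValue-fixes-< {suc t} {suc v} (s≤s v<t) = trans (swapValue-suc t v) (cong suc (swapValue-fixes-< v<t))

swapValue-fixes-> : ∀ {t v} → suc t < v → swapValue t v ≡ v
swapValue-fixes-> {zero} {suc zero} (s≤s ())
swapValue-fixes-> {zero} {suc (suc v)} _ = refl
swapValue-fixes-> {suc t} {suc v} (s≤s t<v) = trans (swapValue-suc t v) (cong suc (swapValue-fixes-> t<v))

-- Lists are read as total functions: parts 0-based, entries of a permutation
-- 1-based, and every out-of-range lookup returns 0.
nth : List ℕ → ℕ → ℕ
nth [] _ = 0
nth (x ∷ xs) zero = x
nth (x ∷ xs) (suc i) = nth xs i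

entry : Perm → ℕ → ℕ
entry σ zero = 0
entry σ (suc i) = nth σ i

nth-map : ∀ {f} → f 0 ≡ 0 → ∀ σ i → nth (map f σ) i ≡ f (nth σ i)
nth-map f0 [] i = sym f0
nth-map f0 (x ∷ σ) zero = refl
nth-map f0 (x ∷ σ) (suc i) = nth-map f0 σ i

entry-map : ∀ {f} → f 0 ≡ 0 → ∀ σ p → entry (map f σ) p ≡ f (entry σ p)
entry-map f0 σ zero = sym f0
entry-map f0 σ (suc i) = nth-map f0 σ i

nth-length : ∀ μ → nth μ (length μ) ≡ 0
nth-length [] = refl
nth-length (m ∷ μ) = nth-length μ

nth-nonzero⇒< : ∀ σ i → nth σ i ≢ 0 → i < length σ
nth-nonzero⇒< [] i nz = ⊥-elim (nz refl)
nth-nonzero⇒< (x ∷ σ) zero nz = s≤s z≤n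
nth-nonzero⇒< (x ∷ σ) (suc i) nz = s≤s (nth-nonzero⇒< σ i nz)

nth-++ˡ : ∀ xs ys {i} → i < length xs → nth (xs ++ ys) i ≡ nth xs i
nth-++ˡ (x ∷ xs) ys {zero} _ = refl
nth-++ˡ (x ∷ xs) ys {suc i} (s≤s i<ℓ) = nth-++ˡ xs ys i<ℓ

nth-++ʳ : ∀ xs ys i → nth (xs ++ ys) (length xs + i) ≡ nth ys i
nth-++ʳ [] ys i = refl
nth-++ʳ (x ∷ xs) ys i = nth-++ʳ xs ys i

nth-map-downFrom : ∀ (f : ℕ → ℕ) {a i} → i ≤ a → nth (map f (downFrom (suc a))) i ≡ f (a ∸ i)
nth-map-downFrom f {a} {zero} _ = refl
nth-map-downFrom f {suc a} {suc i} (s≤s i≤a) = nth-map-downFrom f i≤a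

length-swapPos : ∀ t σ → length (swapPos t σ) ≡ length σ
length-swapPos _ [] = refl
length-swapPos _ (x ∷ []) = refl
length-swapPos zero (x ∷ y ∷ zs) = refl
length-swapPos (suc zero) (x ∷ y ∷ zs) = refl
length-swapPos (suc (suc t)) (x ∷ y ∷ zs) = cong suc (length-swapPos (suc t) (y ∷ zs))

entry-swapPos : ∀ {t} σ p → 1 ≤ t → t < length σ → entry (swapPos t σ) p ≡ entry σ (swapValue t p)
entry-swapPos {zero} _ _ () _
entry-swapPos {suc _} (x ∷ []) _ _ (s≤s ())
entry-swapPos {suc zero} (x ∷ y ∷ zs) zero _ _ = refl
entry-swapPos {suc zero} (x ∷ y ∷ zs) (suc zero) _ _ = refl
entry-swapPos {suc zero} (x ∷ y ∷ zs) (suc (suc zero)) _ _ = refl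
entry-swapPos {suc zero} (x ∷ y ∷ zs) (suc (suc (suc p))) _ _ = refl
entry-swapPos {suc (suc t)} (x ∷ y ∷ zs) zero _ _ = refl
entry-swapPos {suc (suc t)} (x ∷ y ∷ zs) (suc zero) _ _ = refl
entry-swapPos {suc (suc t)} (x ∷ y ∷ zs) (suc (suc p)) _ (s≤s t<) = begin
  entry (swapPos (suc t) (y ∷ zs)) (suc p)            ≡⟨ entry-swapPos (y ∷ zs) (suc p) (s≤s z≤n) t< ⟩
  entry (y ∷ zs) (swapValue (suc t) (suc p))          ≡⟨ cong (entry (y ∷ zs)) (swapValue-suc t p) ⟩
  entry (x ∷ y ∷ zs) (suc (suc (swapValue t p)))      ≡⟨ cong (entry (x ∷ y ∷ zs) ∘ suc) (sym (swapValue-suc t p)) ⟩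
  entry (x ∷ y ∷ zs) (suc (swapValue (suc t) (suc p))) ≡⟨ cong (entry (x ∷ y ∷ zs)) (sym (swapValue-suc (suc t) (suc p))) ⟩
  entry (x ∷ y ∷ zs) (swapValue (suc (suc t)) (suc (suc p))) ∎
  where open ≡-Reasoning

partition-tail : ∀ {m ν} → IsPartition (m ∷ ν) → IsPartition ν
partition-tail [ _ ] = []
partition-tail (_ ∷ p) = p

partition-tail-≤-head : ∀ {m ν} → IsPartition (m ∷ ν) → All (_≤ m) ν
partition-tail-≤-head [ _ ] = []
partition-tail-≤-head (n≤m ∷ p) = n≤m ∷ All.map (λ k≤n → ≤-trans k≤n n≤m) (partition-tail-≤-head p)

partition-head-positive : ∀ {m ν} → IsPartition (m ∷ ν) → 1 ≤ m
partition-head-positive [ 1≤m ] = 1≤m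
partition-head-positive (n≤m ∷ p) = ≤-trans (partition-head-positive p) n≤m

length≤sum : ∀ {μ} → IsPartition μ → length μ ≤ sum μ
length≤sum [] = z≤n
length≤sum [ 1≤m ] = ≤-trans 1≤m (m≤m+n _ 0)
length≤sum (n≤m ∷ p) = +-mono-≤ (≤-trans (partition-head-positive p) n≤m) (length≤sum p)

partition-ext : ∀ {μ₁ μ₂} → IsPartition μ₁ → IsPartition μ₂ →
  (∀ i → i ≤ length μ₁ → i ≤ length μ₂ → nth μ₁ i ≡ nth μ₂ i) → μ₁ ≡ μ₂
partition-ext {[]} {[]} _ _ _ = refl
partition-ext {[]} {m ∷ _} _ p same = ⊥-elim (<-irrefl (same 0 z≤n z≤n) (partition-head-positive p))
partition-ext {m ∷ _} {[]} p _ same = ⊥-elim (<-irrefl (sym (same 0 z≤n z≤n)) (partition-head-positive p))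
partition-ext {m ∷ μ₁} {n ∷ μ₂} p₁ p₂ same =
  cong₂ _∷_ (same 0 z≤n z≤n)
            (partition-ext (partition-tail p₁) (partition-tail p₂) (λ i i≤₁ i≤₂ → same (suc i) (s≤s i≤₁) (s≤s i≤₂)))

jumpPart-< : ∀ {c₁ c₂ μ} → IsJumpPart c₁ c₂ μ → All (_< c₂) μ
jumpPart-< {μ = []} _ = []
jumpPart-< {μ = m ∷ μ} (p , _ , m<c₂) = m<c₂ ∷ All.map (λ k≤m → ≤-<-trans k≤m m<c₂) (partition-tail-≤-head p)

cycle : ℕ → ℕ → ℕ → ℕ
cycle a zero v = v
cycle a (suc m) v = swapValue (a + suc m) (cycle a m v)

cycle⁻¹ : ℕ → ℕ → ℕ → ℕ
cycle⁻¹ a zero v = v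
cycle⁻¹ a (suc m) v = cycle⁻¹ a m (swapValue (a + suc m) v)

cycle⁻¹-cycle : ∀ a m v → cycle⁻¹ a m (cycle a m v) ≡ v
cycle⁻¹-cycle a zero v = refl
cycle⁻¹-cycle a (suc m) v =
  trans (cong (cycle⁻¹ a m) (swapValue-involutive (a + suc m) _)) (cycle⁻¹-cycle a m v)

cycle-cycle⁻¹ : ∀ a m v → cycle a m (cycle⁻¹ a m v) ≡ v
cycle-cycle⁻¹ a zero v = refl
cycle-cycle⁻¹ a (suc m) v =
  trans (cong (swapValue (a + suc m)) (cycle-cycle⁻¹ a m _)) (swapValue-involutive (a + suc m) v)

cycle-fixes-≤ : ∀ a m {v} → v ≤ a → cycle a m v ≡ v
cycle-fixes-≤ a zero v≤a = refl
cycle-fixes-≤ a (suc m) {v} v≤a rewrite cycle-fixes-≤ a m v≤a =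
  swapValue-fixes-< (≤-<-trans v≤a (m<m+n a (s≤s z≤n)))

cycle-zero : ∀ a m → cycle a m 0 ≡ 0
cycle-zero a m = cycle-fixes-≤ a m z≤n

cycle-fixes-> : ∀ a m {v} → suc (a + m) < v → cycle a m v ≡ v
cycle-fixes-> a zero _ = refl
cycle-fixes-> a (suc m) {v} a+m+1<v
  rewrite cycle-fixes-> a m (≤-<-trans (s≤s (+-monoʳ-≤ a (n≤1+n m))) a+m+1<v) =
  swapValue-fixes-> a+m+1<v

cycle-start : ∀ a m → cycle a m (suc a) ≡ suc (a + m)
cycle-start a zero = cong suc (sym (+-identityʳ a))
cycle-start a (suc m) rewrite cycle-start a m | +-suc a m = swapValue-same (suc (a + m))

-- For c₁ = a + 1, the outer action ν ∘ σ relabels the values of σ by jumpMap a ν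
-- (row j of ν acts as cycle (a + 1 - j)), and the inner action σ ∘ μ reads σ at
-- the positions jumpMap⁻¹ a μ.
jumpMap : ℕ → List ℕ → ℕ → ℕ
jumpMap a [] v = v
jumpMap a (m ∷ ν) v = jumpMap (pred a) ν (cycle a m v)

jumpMap⁻¹ : ℕ → List ℕ → ℕ → ℕ
jumpMap⁻¹ a [] v = v
jumpMap⁻¹ a (m ∷ μ) v = cycle⁻¹ a m (jumpMap⁻¹ (pred a) μ v)

jumpMap⁻¹-jumpMap : ∀ a ν v → jumpMap⁻¹ a ν (jumpMap a ν v) ≡ v
jumpMap⁻¹-jumpMap a [] v = refl
jumpMap⁻¹-jumpMap a (m ∷ ν) v =
  trans (cong (cycle⁻¹ a m) (jumpMap⁻¹-jumpMap (pred a) ν _)) (cycle⁻¹-cycle a m v)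

jumpMap-jumpMap⁻¹ : ∀ a ν v → jumpMap a ν (jumpMap⁻¹ a ν v) ≡ v
jumpMap-jumpMap⁻¹ a [] v = refl
jumpMap-jumpMap⁻¹ a (m ∷ ν) v =
  trans (cong (jumpMap (pred a) ν) (cycle-cycle⁻¹ a m _)) (jumpMap-jumpMap⁻¹ (pred a) ν v)

jumpMap-injective : ∀ a ν {v w} → jumpMap a ν v ≡ jumpMap a ν w → v ≡ w
jumpMap-injective a ν {v} {w} eq =
  trans (sym (jumpMap⁻¹-jumpMap a ν v)) (trans (cong (jumpMap⁻¹ a ν) eq) (jumpMap⁻¹-jumpMap a ν w))

jumpMap⁻¹-injective : ∀ a μ {v w} → jumpMap⁻¹ a μ v ≡ jumpMap⁻¹ a μ w → v ≡ w
jumpMap⁻¹-injective a μ {v} {w} eq =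
  trans (sym (jumpMap-jumpMap⁻¹ a μ v)) (trans (cong (jumpMap a μ) eq) (jumpMap-jumpMap⁻¹ a μ w))

jumpMap-zero : ∀ a ν → jumpMap a ν 0 ≡ 0
jumpMap-zero a [] = refl
jumpMap-zero a (m ∷ ν) rewrite cycle-zero a m = jumpMap-zero (pred a) ν

n≤suc[pred[n]] : ∀ n → n ≤ suc (pred n)
n≤suc[pred[n]] zero = z≤n
n≤suc[pred[n]] (suc n) = ≤-refl

jumpMap-fixes-≤ : ∀ a ν {v} → v + length ν ≤ suc a → jumpMap a ν v ≡ v
jumpMap-fixes-≤ a [] _ = refl
jumpMap-fixes-≤ a (m ∷ ν) {v} v+ℓ<a+1 =
  trans (cong (jumpMap (pred a) ν) (cycle-fixes-≤ a m v≤a)) (jumpMap-fixes-≤ (pred a) ν v+ℓ≤)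
  where
  v+ℓ≤a : v + length ν ≤ a
  v+ℓ≤a = ≤-pred (≤-trans (≤-reflexive (sym (+-suc v (length ν)))) v+ℓ<a+1)
  v≤a : v ≤ a
  v≤a = m+n≤o⇒m≤o v v+ℓ≤a
  v+ℓ≤ : v + length ν ≤ suc (pred a)
  v+ℓ≤ = ≤-trans v+ℓ≤a (n≤suc[pred[n]] a)

jumpMap-fixes-> : ∀ a ν {h v} → All (_≤ h) ν → suc (a + h) < v → jumpMap a ν v ≡ v
jumpMap-fixes-> a [] _ _ = refl
jumpMap-fixes-> a (m ∷ ν) {h} (m≤h ∷ ν≤h) a+h+1<v =
  trans (cong (jumpMap (pred a) ν) (cycle-fixes-> a m (≤-<-trans (s≤s (+-monoʳ-≤ a m≤h)) a+h+1<v)))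
        (jumpMap-fixes-> (pred a) ν ν≤h (≤-<-trans (s≤s (+-monoˡ-≤ h pred[n]≤n)) a+h+1<v))

-- Only row i of ν moves the value a + 1 - i (rows counted from 0): the rows
-- before it act above it, the rows after it act below it.
jumpMap-diagonal : ∀ a ν i → IsPartition ν → i ≤ a → length ν ≤ suc a →
  jumpMap a ν (suc (a ∸ i)) ≡ suc (a ∸ i) + nth ν i
jumpMap-diagonal a [] i _ _ _ = sym (+-identityʳ _)
jumpMap-diagonal zero (m ∷ []) zero _ _ _ = cycle-start zero m
jumpMap-diagonal zero (m ∷ _ ∷ _) zero _ _ (s≤s ())
jumpMap-diagonal (suc a) (m ∷ ν) zero p _ _ rewrite cycle-start (suc a) m =
  jumpMap-fixes-> a ν (partition-tail-≤-head p) ≤-refl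
jumpMap-diagonal (suc a) (m ∷ ν) (suc i) p (s≤s i≤a) (s≤s ℓ≤a)
  rewrite cycle-fixes-≤ (suc a) m (s≤s (m∸n≤m a i)) = jumpMap-diagonal a ν i (partition-tail p) i≤a ℓ≤a

jumpMap⁻¹-fixes-≤ : ∀ a μ {v} → v + length μ ≤ suc a → jumpMap⁻¹ a μ v ≡ v
jumpMap⁻¹-fixes-≤ a μ {v} le =
  trans (cong (jumpMap⁻¹ a μ) (sym (jumpMap-fixes-≤ a μ le))) (jumpMap⁻¹-jumpMap a μ v)

jumpMap⁻¹-diagonal : ∀ a μ i → IsPartition μ → i ≤ a → length μ ≤ suc a →
  jumpMap⁻¹ a μ (suc (a ∸ i) + nth μ i) ≡ suc (a ∸ i)
jumpMap⁻¹-diagonal a μ i p i≤a ℓ≤a =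
  trans (cong (jumpMap⁻¹ a μ) (sym (jumpMap-diagonal a μ i p i≤a ℓ≤a))) (jumpMap⁻¹-jumpMap a μ _)

outerRow-map : ∀ c₁ j m σ → outerRow c₁ j m σ ≡ map (cycle (c₁ ∸ j) m) σ
outerRow-map c₁ j zero σ = sym (map-id σ)
outerRow-map c₁ j (suc m) σ = begin
  foldl step σ (upTo (suc m))                                    ≡⟨ cong (foldl step σ) (sym (upTo-∷ʳ m)) ⟩
  foldl step σ (upTo m ∷ʳ m)                                     ≡⟨ foldl-∷ʳ step σ m (upTo m) ⟩
  swapVal (c₁ ∸ j + suc m) (outerRow c₁ j m σ)                   ≡⟨ cong (swapVal (c₁ ∸ j + suc m)) (outerRow-map c₁ j m σ) ⟩
  map (swapValue (c₁ ∸ j + suc m)) (map (cycle (c₁ ∸ j) m) σ)    ≡⟨ sym (map-∘ σ) ⟩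
  map (cycle (c₁ ∸ j) (suc m)) σ                                 ∎
  where
  open ≡-Reasoning
  step : Perm → ℕ → Perm
  step τ k = swapVal (c₁ ∸ j + suc k) τ

entry-outerAux : ∀ c₁ j ν σ p → entry (outerAux c₁ j ν σ) p ≡ jumpMap (c₁ ∸ j) ν (entry σ p)
entry-outerAux c₁ j [] σ p = refl
entry-outerAux c₁ j (m ∷ ν) σ p = begin
  entry (outerAux c₁ (suc j) ν (outerRow c₁ j m σ)) p             ≡⟨ entry-outerAux c₁ (suc j) ν _ p ⟩
  jumpMap (c₁ ∸ suc j) ν (entry (outerRow c₁ j m σ) p)            ≡⟨ cong (jumpMap (c₁ ∸ suc j) ν) entry-row ⟩
  jumpMap (c₁ ∸ suc j) ν (cycle (c₁ ∸ j) m (entry σ p))           ≡⟨ cong (λ b → jumpMap b ν (cycle (c₁ ∸ j) m (entry σ p))) (sym (pred[m∸n]≡m∸[1+n] c₁ j)) ⟩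
  jumpMap (pred (c₁ ∸ j)) ν (cycle (c₁ ∸ j) m (entry σ p))        ∎
  where
  open ≡-Reasoning
  entry-row : entry (outerRow c₁ j m σ) p ≡ cycle (c₁ ∸ j) m (entry σ p)
  entry-row = trans (cong (λ τ → entry τ p) (outerRow-map c₁ j m σ)) (entry-map (cycle-zero _ m) σ p)

innerRow-suc : ∀ c₁ j m σ → innerRow c₁ j (suc m) σ ≡ swapPos (c₁ ∸ j + suc m) (innerRow c₁ j m σ)
innerRow-suc c₁ j m σ = trans (cong (foldl step σ) (sym (upTo-∷ʳ m))) (foldl-∷ʳ step σ m (upTo m))
  where
  step : Perm → ℕ → Perm
  step τ k = swapPos (c₁ ∸ j + suc k) τ

length-innerRow : ∀ c₁ j m σ → length (innerRow c₁ j m σ) ≡ length σ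
length-innerRow c₁ j zero σ = refl
length-innerRow c₁ j (suc m) σ rewrite innerRow-suc c₁ j m σ =
  trans (length-swapPos _ (innerRow c₁ j m σ)) (length-innerRow c₁ j m σ)

entry-innerRow : ∀ c₁ j m σ p → c₁ ∸ j + m < length σ →
  entry (innerRow c₁ j m σ) p ≡ entry σ (cycle⁻¹ (c₁ ∸ j) m p)
entry-innerRow c₁ j zero σ p _ = refl
entry-innerRow c₁ j (suc m) σ p lt rewrite innerRow-suc c₁ j m σ =
  trans (entry-swapPos (innerRow c₁ j m σ) p (≤-trans (s≤s z≤n) (m≤n+m (suc m) (c₁ ∸ j)))
                       (subst (c₁ ∸ j + suc m <_) (sym (length-innerRow c₁ j m σ)) lt))
        (entry-innerRow c₁ j m σ _ (≤-<-trans (+-monoʳ-≤ (c₁ ∸ j) (n≤1+n m)) lt))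

entry-innerAux : ∀ c₁ j μ σ p → All (λ m → c₁ + m < length σ) μ →
  entry (innerAux c₁ j μ σ) p ≡ entry σ (jumpMap⁻¹ (c₁ ∸ j) μ p)
entry-innerAux c₁ j [] σ p _ = refl
entry-innerAux c₁ j (m ∷ μ) σ p (lt ∷ lts) = begin
  entry (innerAux c₁ (suc j) μ (innerRow c₁ j m σ)) p              ≡⟨ entry-innerAux c₁ (suc j) μ _ p lts′ ⟩
  entry (innerRow c₁ j m σ) (jumpMap⁻¹ (c₁ ∸ suc j) μ p)           ≡⟨ entry-innerRow c₁ j m σ _ (≤-<-trans (+-monoˡ-≤ m (m∸n≤m c₁ j)) lt) ⟩
  entry σ (cycle⁻¹ (c₁ ∸ j) m (jumpMap⁻¹ (c₁ ∸ suc j) μ p))        ≡⟨ cong (λ b → entry σ (cycle⁻¹ (c₁ ∸ j) m (jumpMap⁻¹ b μ p))) (sym (pred[m∸n]≡m∸[1+n] c₁ j)) ⟩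
  entry σ (cycle⁻¹ (c₁ ∸ j) m (jumpMap⁻¹ (pred (c₁ ∸ j)) μ p))     ∎
  where
  open ≡-Reasoning
  lts′ : All (λ k → c₁ + k < length (innerRow c₁ j m σ)) μ
  lts′ = All.map (subst (c₁ + _ <_) (sym (length-innerRow c₁ j m σ))) lts

length-map-downFrom : ∀ (f : ℕ → ℕ) c → length (map f (downFrom c)) ≡ c
length-map-downFrom f c = trans (length-map f (downFrom c)) (length-downFrom c)

length-minPerm : ∀ c₁ c₂ → length (minPerm c₁ c₂) ≡ c₁ + c₂
length-minPerm c₁ c₂ =
  trans (length-++ (map suc (downFrom c₁)))
        (cong₂ _+_ (length-map-downFrom suc c₁) (length-map-downFrom (λ i → c₁ + suc i) c₂))

minPerm-entry-≤ : ∀ {a i} c₂ → i ≤ a → entry (minPerm (suc a) c₂) (suc i) ≡ suc (a ∸ i)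
minPerm-entry-≤ {a} {i} c₂ i≤a =
  trans (nth-++ˡ (map suc (downFrom (suc a))) _ (subst (i <_) (sym (length-map-downFrom suc (suc a))) (s≤s i≤a)))
        (nth-map-downFrom suc i≤a)

minPerm-entry-> : ∀ c₁ {d q} → q ≤ d → entry (minPerm c₁ (suc d)) (suc (c₁ + q)) ≡ c₁ + suc (d ∸ q)
minPerm-entry-> c₁ {d} {q} q≤d = begin
  nth (low ++ high) (c₁ + q)             ≡⟨ cong (λ k → nth (low ++ high) (k + q)) (sym (length-map-downFrom suc c₁)) ⟩
  nth (low ++ high) (length low + q)     ≡⟨ nth-++ʳ low high q ⟩
  nth high q                             ≡⟨ nth-map-downFrom (λ k → c₁ + suc k) q≤d ⟩
  c₁ + suc (d ∸ q)                       ∎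
  where
  open ≡-Reasoning
  low high : List ℕ
  low = map suc (downFrom c₁)
  high = map (λ k → c₁ + suc k) (downFrom (suc d))

-- minPerm c₁ c₂ reverses each of the blocks [1, c₁] and [c₁ + 1, c₁ + c₂].
minPerm-involutive : ∀ c₁ c₂ {i} → i < c₁ + c₂ → entry (minPerm c₁ c₂) (entry (minPerm c₁ c₂) (suc i)) ≡ suc i
minPerm-involutive c₁ c₂ {i} i<n with i <? c₁
minPerm-involutive (suc a) c₂ {i} _ | yes (s≤s i≤a) = begin
  entry π (entry π (suc i))   ≡⟨ cong (entry π) (minPerm-entry-≤ c₂ i≤a) ⟩
  entry π (suc (a ∸ i))       ≡⟨ minPerm-entry-≤ c₂ (m∸n≤m a i) ⟩
  suc (a ∸ (a ∸ i))           ≡⟨ cong suc (m∸[m∸n]≡n i≤a) ⟩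
  suc i                       ∎
  where
  open ≡-Reasoning
  π : Perm
  π = minPerm (suc a) c₂
... | no i≮c₁ with m≤n⇒∃[o]m+o≡n (≮⇒≥ i≮c₁)
minPerm-involutive c₁ zero {i} i<n | no _ | q , refl with () ← +-cancelˡ-< c₁ q 0 i<n
minPerm-involutive c₁ (suc d) {i} i<n | no _ | q , refl = begin
  entry π (entry π (suc (c₁ + q)))       ≡⟨ cong (entry π) (trans (minPerm-entry-> c₁ q≤d) (+-suc c₁ (d ∸ q))) ⟩
  entry π (suc (c₁ + (d ∸ q)))           ≡⟨ minPerm-entry-> c₁ (m∸n≤m d q) ⟩
  c₁ + suc (d ∸ (d ∸ q))                 ≡⟨ cong (λ k → c₁ + suc k) (m∸[m∸n]≡n q≤d) ⟩
  c₁ + suc q                             ≡⟨ +-suc c₁ q ⟩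
  suc (c₁ + q)                           ∎
  where
  open ≡-Reasoning
  π : Perm
  π = minPerm c₁ (suc d)
  q≤d : q ≤ d
  q≤d = ≤-pred (+-cancelˡ-< c₁ q (suc d) i<n)

minPerm-injective : ∀ c₁ c₂ {x y} → entry (minPerm c₁ c₂) x ≡ entry (minPerm c₁ c₂) y →
  entry (minPerm c₁ c₂) x ≢ 0 → x ≡ y
minPerm-injective c₁ c₂ {zero} _ nz = ⊥-elim (nz refl)
minPerm-injective c₁ c₂ {suc i} {zero} eq nz = ⊥-elim (nz eq)
minPerm-injective c₁ c₂ {suc i} {suc j} eq nz = begin
  suc i                      ≡⟨ sym (minPerm-involutive c₁ c₂ (in-range i nz)) ⟩
  entry π (entry π (suc i))  ≡⟨ cong (entry π) eq ⟩
  entry π (entry π (suc j))  ≡⟨ minPerm-involutive c₁ c₂ (in-range j (λ z → nz (trans eq z))) ⟩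
  suc j                      ∎
  where
  open ≡-Reasoning
  π : Perm
  π = minPerm c₁ c₂
  in-range : ∀ k → nth π k ≢ 0 → k < c₁ + c₂
  in-range k nz′ = subst (k <_) (length-minPerm c₁ c₂) (nth-nonzero⇒< π k nz′)

jumped : ℕ → ℕ → List ℕ → List ℕ → Perm
jumped a c₂ μ ν = applyJ (suc a) (μ , ν) (minPerm (suc a) c₂)

entry-jumped : ∀ a c₂ μ ν p → All (_< c₂) μ →
  entry (jumped a c₂ μ ν) p ≡ jumpMap a ν (entry (minPerm (suc a) c₂) (jumpMap⁻¹ a μ p))
entry-jumped a c₂ μ ν p μ<c₂ =
  trans (entry-outerAux (suc a) 1 ν _ p) (cong (jumpMap a ν) (entry-innerAux (suc a) 1 μ _ p (All.map fits μ<c₂)))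
  where
  fits : ∀ {m} → m < c₂ → suc a + m < length (minPerm (suc a) c₂)
  fits {m} m<c₂ = subst (suc a + m <_) (sym (length-minPerm (suc a) c₂)) (+-monoʳ-< (suc a) m<c₂)

jumped-injective : ∀ a c₂ μ ν {p q} → All (_< c₂) μ →
  entry (jumped a c₂ μ ν) p ≡ entry (jumped a c₂ μ ν) q → entry (jumped a c₂ μ ν) p ≢ 0 → p ≡ q
jumped-injective a c₂ μ ν {p} {q} μ<c₂ eq nz =
  jumpMap⁻¹-injective a μ (minPerm-injective (suc a) c₂ (jumpMap-injective a ν eq′)
    (λ z → nz (trans (entry-jumped a c₂ μ ν p μ<c₂) (trans (cong (jumpMap a ν) z) (jumpMap-zero a ν)))))
  where
  eq′ : jumpMap a ν (entry (minPerm (suc a) c₂) (jumpMap⁻¹ a μ p)) ≡ jumpMap a ν (entry (minPerm (suc a) c₂) (jumpMap⁻¹ a μ q))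
  eq′ = trans (sym (entry-jumped a c₂ μ ν p μ<c₂)) (trans eq (entry-jumped a c₂ μ ν q μ<c₂))

jumped-position : ∀ a c₂ μ ν i → IsPartition μ → All (_< c₂) μ → length μ ≤ suc a →
  suc i + length ν ≤ suc a → entry (jumped a c₂ μ ν) (suc (a ∸ i) + nth μ i) ≡ suc i
jumped-position a c₂ μ ν i μ-part μ<c₂ ℓμ≤ i+ℓν< = begin
  entry (jumped a c₂ μ ν) (suc (a ∸ i) + nth μ i)               ≡⟨ entry-jumped a c₂ μ ν _ μ<c₂ ⟩
  jumpMap a ν (entry π (jumpMap⁻¹ a μ (suc (a ∸ i) + nth μ i))) ≡⟨ cong (jumpMap a ν ∘ entry π) (jumpMap⁻¹-diagonal a μ i μ-part i≤a ℓμ≤) ⟩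
  jumpMap a ν (entry π (suc (a ∸ i)))                            ≡⟨ cong (jumpMap a ν) (minPerm-entry-≤ c₂ (m∸n≤m a i)) ⟩
  jumpMap a ν (suc (a ∸ (a ∸ i)))                                ≡⟨ cong (jumpMap a ν ∘ suc) (m∸[m∸n]≡n i≤a) ⟩
  jumpMap a ν (suc i)                                            ≡⟨ jumpMap-fixes-≤ a ν i+ℓν< ⟩
  suc i                                                          ∎
  where
  open ≡-Reasoning
  π : Perm
  π = minPerm (suc a) c₂
  i≤a : i ≤ a
  i≤a = ≤-pred (m+n≤o⇒m≤o (suc i) i+ℓν<)

jumped-value : ∀ a c₂ μ ν i → IsPartition ν → All (_< c₂) μ → length ν ≤ suc a →
  suc i + length μ ≤ suc a → entry (jumped a c₂ μ ν) (suc i) ≡ suc (a ∸ i) + nth ν i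
jumped-value a c₂ μ ν i ν-part μ<c₂ ℓν≤ i+ℓμ< = begin
  entry (jumped a c₂ μ ν) (suc i)                  ≡⟨ entry-jumped a c₂ μ ν _ μ<c₂ ⟩
  jumpMap a ν (entry π (jumpMap⁻¹ a μ (suc i)))    ≡⟨ cong (jumpMap a ν ∘ entry π) (jumpMap⁻¹-fixes-≤ a μ i+ℓμ<) ⟩
  jumpMap a ν (entry π (suc i))                    ≡⟨ cong (jumpMap a ν) (minPerm-entry-≤ c₂ i≤a) ⟩
  jumpMap a ν (suc (a ∸ i))                        ≡⟨ jumpMap-diagonal a ν i ν-part i≤a ℓν≤ ⟩
  suc (a ∸ i) + nth ν i                            ∎
  where
  open ≡-Reasoning
  π : Perm
  π = minPerm (suc a) c₂
  i≤a : i ≤ a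
  i≤a = ≤-pred (m+n≤o⇒m≤o (suc i) i+ℓμ<)

record SmallJump (a c₂ : ℕ) (μ ν : List ℕ) : Set where
  field
    μ-partition : IsPartition μ
    ν-partition : IsPartition ν
    μ<c₂ : All (_< c₂) μ
    lengths≤a : length μ + length ν ≤ a

  length-μ≤ : length μ ≤ suc a
  length-μ≤ = m≤n⇒m≤1+n (m+n≤o⇒m≤o (length μ) lengths≤a)

  length-ν≤ : length ν ≤ suc a
  length-ν≤ = m≤n⇒m≤1+n (m+n≤o⇒n≤o (length μ) lengths≤a)

  μ-index-bound : ∀ {i} → i ≤ length μ → suc i + length ν ≤ suc a
  μ-index-bound i≤ℓ = s≤s (≤-trans (+-monoˡ-≤ (length ν) i≤ℓ) lengths≤a)

  ν-index-bound : ∀ {i} → i ≤ length ν → suc i + length μ ≤ suc a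
  ν-index-bound {i} i≤ℓ = s≤s (≤-trans (≤-reflexive (+-comm i (length μ))) (≤-trans (+-monoʳ-≤ (length μ) i≤ℓ) lengths≤a))

smallJump : ∀ {a c₂ r μ ν} → IsJump (suc a) c₂ (μ , ν) → size (μ , ν) < r → r ≤ suc a → SmallJump a c₂ μ ν
smallJump (jμ@(μ-part , _) , (ν-part , _)) size<r r≤ = record
  { μ-partition = μ-part
  ; ν-partition = ν-part
  ; μ<c₂ = jumpPart-< jμ
  ; lengths≤a = ≤-pred (≤-trans (s≤s (+-mono-≤ (length≤sum μ-part) (length≤sum ν-part))) (≤-trans size<r r≤))
  }

jumped-determines-jump : ∀ {a c₂ μ₁ ν₁ μ₂ ν₂} → SmallJump a c₂ μ₁ ν₁ → SmallJump a c₂ μ₂ ν₂ →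
  jumped a c₂ μ₁ ν₁ ≡ jumped a c₂ μ₂ ν₂ → μ₁ ≡ μ₂ × ν₁ ≡ ν₂
jumped-determines-jump {a} {c₂} {μ₁} {ν₁} {μ₂} {ν₂} J₁ J₂ τ₁≡τ₂ = μ₁≡μ₂ , ν₁≡ν₂
  where
  module J₁ = SmallJump J₁
  module J₂ = SmallJump J₂

  same-μ : ∀ i → i ≤ length μ₁ → i ≤ length μ₂ → nth μ₁ i ≡ nth μ₂ i
  same-μ i i≤₁ i≤₂ = +-cancelˡ-≡ (suc (a ∸ i)) _ _
    (jumped-injective a c₂ μ₂ ν₂ J₂.μ<c₂ (trans in-τ₂ (sym at₂)) (λ z → 0≢1+n (trans (sym z) in-τ₂)))
    where
    at₁ : entry (jumped a c₂ μ₁ ν₁) (suc (a ∸ i) + nth μ₁ i) ≡ suc i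
    at₁ = jumped-position a c₂ μ₁ ν₁ i J₁.μ-partition J₁.μ<c₂ J₁.length-μ≤ (J₁.μ-index-bound i≤₁)
    at₂ : entry (jumped a c₂ μ₂ ν₂) (suc (a ∸ i) + nth μ₂ i) ≡ suc i
    at₂ = jumped-position a c₂ μ₂ ν₂ i J₂.μ-partition J₂.μ<c₂ J₂.length-μ≤ (J₂.μ-index-bound i≤₂)
    in-τ₂ : entry (jumped a c₂ μ₂ ν₂) (suc (a ∸ i) + nth μ₁ i) ≡ suc i
    in-τ₂ = trans (cong (λ τ → entry τ (suc (a ∸ i) + nth μ₁ i)) (sym τ₁≡τ₂)) at₁

  μ₁≡μ₂ : μ₁ ≡ μ₂
  μ₁≡μ₂ = partition-ext J₁.μ-partition J₂.μ-partition same-μ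

  same-ν : ∀ i → i ≤ length ν₁ → i ≤ length ν₂ → nth ν₁ i ≡ nth ν₂ i
  same-ν i i≤₁ i≤₂ = +-cancelˡ-≡ (suc (a ∸ i)) _ _ (begin
    suc (a ∸ i) + nth ν₁ i            ≡⟨ sym (jumped-value a c₂ μ₁ ν₁ i J₁.ν-partition J₁.μ<c₂ J₁.length-ν≤ (J₁.ν-index-bound i≤₁)) ⟩
    entry (jumped a c₂ μ₁ ν₁) (suc i) ≡⟨ cong (λ τ → entry τ (suc i)) τ₁≡τ₂ ⟩
    entry (jumped a c₂ μ₂ ν₂) (suc i) ≡⟨ jumped-value a c₂ μ₂ ν₂ i J₂.ν-partition J₂.μ<c₂ J₂.length-ν≤ (J₂.ν-index-bound i≤₂) ⟩
    suc (a ∸ i) + nth ν₂ i            ∎)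
    where open ≡-Reasoning

  ν₁≡ν₂ : ν₁ ≡ ν₂
  ν₁≡ν₂ = partition-ext J₁.ν-partition J₂.ν-partition same-ν

+-cross : ∀ A B C D → (C + B) + (D + A) ≡ (A + B) + (C + D)
+-cross = solve-∀

one-cross-sum-≤ : ∀ {a} A B C D → A + B ≤ a → C + D ≤ a → C + B ≤ a ⊎ D + A ≤ a
one-cross-sum-≤ {a} A B C D AB≤a CD≤a with C + B ≤? a
... | yes CB≤a = inj₁ CB≤a
... | no CB≰a = inj₂ (≤-pred (+-cancelˡ-< a (D + A) (suc a) (begin-strict
  a + (D + A)        <⟨ +-monoˡ-< (D + A) (≰⇒> CB≰a) ⟩
  (C + B) + (D + A)  ≡⟨ +-cross A B C D ⟩
  (A + B) + (C + D)  ≤⟨ +-mono-≤ AB≤a CD≤a ⟩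
  a + a              <⟨ +-monoʳ-< a (n<1+n a) ⟩
  a + suc a          ∎)))
  where open ≤-Reasoning

descent-gap : ∀ {a b} i k → b < a → i ≤ b → suc (a ∸ i) + k ≢ suc (b ∸ i) + 0
descent-gap {a} {b} i k b<a i≤b eq = <-irrefl (sym eq) (begin-strict
  suc (b ∸ i) + 0  ≡⟨ +-identityʳ _ ⟩
  suc (b ∸ i)      <⟨ s≤s (∸-monoˡ-< b<a i≤b) ⟩
  suc (a ∸ i)      ≤⟨ m≤m+n _ k ⟩
  suc (a ∸ i) + k  ∎)
  where open ≤-Reasoning

jumped-separates : ∀ {a b c₂ d₂ μ₁ ν₁ μ₂ ν₂} → b < a → SmallJump a c₂ μ₁ ν₁ → SmallJump b d₂ μ₂ ν₂ →
  jumped a c₂ μ₁ ν₁ ≢ jumped b d₂ μ₂ ν₂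
jumped-separates {a} {b} {c₂} {d₂} {μ₁} {ν₁} {μ₂} {ν₂} b<a J₁ J₂ τ₁≡τ₂ =
  [ compare-positions , compare-values ]′
    (one-cross-sum-≤ (length μ₁) (length ν₁) (length μ₂) (length ν₂) J₁.lengths≤a (≤-trans J₂.lengths≤a (<⇒≤ b<a)))
  where
  module J₁ = SmallJump J₁
  module J₂ = SmallJump J₂

  compare-positions : length μ₂ + length ν₁ ≤ a → ⊥
  compare-positions C+B≤a = descent-gap C (nth μ₁ C) b<a C≤b (trans P₁≡P₂ (cong (suc (b ∸ C) +_) (nth-length μ₂)))
    where
    C : ℕ
    C = length μ₂
    C≤b : C ≤ b
    C≤b = m+n≤o⇒m≤o C J₂.lengths≤a
    in-τ₂ : entry (jumped b d₂ μ₂ ν₂) (suc (a ∸ C) + nth μ₁ C) ≡ suc C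
    in-τ₂ = trans (cong (λ τ → entry τ (suc (a ∸ C) + nth μ₁ C)) (sym τ₁≡τ₂))
                  (jumped-position a c₂ μ₁ ν₁ C J₁.μ-partition J₁.μ<c₂ J₁.length-μ≤ (s≤s C+B≤a))
    at₂ : entry (jumped b d₂ μ₂ ν₂) (suc (b ∸ C) + nth μ₂ C) ≡ suc C
    at₂ = jumped-position b d₂ μ₂ ν₂ C J₂.μ-partition J₂.μ<c₂ J₂.length-μ≤ (J₂.μ-index-bound ≤-refl)
    P₁≡P₂ : suc (a ∸ C) + nth μ₁ C ≡ suc (b ∸ C) + nth μ₂ C
    P₁≡P₂ = jumped-injective b d₂ μ₂ ν₂ J₂.μ<c₂ (trans in-τ₂ (sym at₂)) (λ z → 0≢1+n (trans (sym z) in-τ₂))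

  compare-values : length ν₂ + length μ₁ ≤ a → ⊥
  compare-values D+A≤a = descent-gap D (nth ν₁ D) b<a D≤b (begin
    suc (a ∸ D) + nth ν₁ D            ≡⟨ sym (jumped-value a c₂ μ₁ ν₁ D J₁.ν-partition J₁.μ<c₂ J₁.length-ν≤ (s≤s D+A≤a)) ⟩
    entry (jumped a c₂ μ₁ ν₁) (suc D) ≡⟨ cong (λ τ → entry τ (suc D)) τ₁≡τ₂ ⟩
    entry (jumped b d₂ μ₂ ν₂) (suc D) ≡⟨ jumped-value b d₂ μ₂ ν₂ D J₂.ν-partition J₂.μ<c₂ J₂.length-ν≤ (J₂.ν-index-bound ≤-refl) ⟩
    suc (b ∸ D) + nth ν₂ D            ≡⟨ cong (suc (b ∸ D) +_) (nth-length ν₂) ⟩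
    suc (b ∸ D) + 0                   ∎)
    where
    open ≡-Reasoning
    D : ℕ
    D = length ν₂
    D≤b : D ≤ b
    D≤b = m+n≤o⇒n≤o (length μ₂) J₂.lengths≤a

jumps-distinct : ∀ {a c₂ r} → r ≤ suc a → ∀ J₁ J₂ → IsJump (suc a) c₂ J₁ → IsJump (suc a) c₂ J₂ →
  size J₁ < r → size J₂ < r → J₁ ≢ J₂ →
  applyJ (suc a) J₁ (minPerm (suc a) c₂) ≢ applyJ (suc a) J₂ (minPerm (suc a) c₂)
jumps-distinct r≤ (μ₁ , ν₁) (μ₂ , ν₂) j₁ j₂ size₁< size₂< J₁≢J₂ τ₁≡τ₂
  with jumped-determines-jump (smallJump j₁ size₁< r≤) (smallJump j₂ size₂< r≤) τ₁≡τ₂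
... | refl , refl = J₁≢J₂ refl

minPerms-distinct : ∀ {a b c₂ d₂ r} → r ≤ suc b → b < a → ∀ J₁ J₂ →
  IsJump (suc a) c₂ J₁ → IsJump (suc b) d₂ J₂ → size J₁ < r → size J₂ < r →
  applyJ (suc a) J₁ (minPerm (suc a) c₂) ≢ applyJ (suc b) J₂ (minPerm (suc b) d₂)
minPerms-distinct r≤ b<a (μ₁ , ν₁) (μ₂ , ν₂) j₁ j₂ size₁< size₂< =
  jumped-separates b<a (smallJump j₁ size₁< (≤-trans r≤ (m≤n⇒m≤1+n b<a))) (smallJump j₂ size₂< r≤)

theorem21 : (s r : ℕ) → r ≤ s → 1 ≤ r →
    ((c₁ c₂ : ℕ) → MinChoice s r c₁ c₂ →
      (J₁ J₂ : JumpPartition) →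
      IsJump c₁ c₂ J₁ → IsJump c₁ c₂ J₂ →
      size J₁ < r → size J₂ < r →
      Valid c₁ J₁ (minPerm c₁ c₂) → Valid c₁ J₂ (minPerm c₁ c₂) →
      J₁ ≢ J₂ →
      applyJ c₁ J₁ (minPerm c₁ c₂) ≢ applyJ c₁ J₂ (minPerm c₁ c₂))
    ×
    ((c₁ c₂ d₁ d₂ : ℕ) → MinChoice s r c₁ c₂ → MinChoice s r d₁ d₂ →
      minPerm c₁ c₂ ≢ minPerm d₁ d₂ →
      (J₁ J₂ : JumpPartition) →
      IsJump c₁ c₂ J₁ → IsJump d₁ d₂ J₂ →
      size J₁ < r → size J₂ < r →
      Valid c₁ J₁ (minPerm c₁ c₂) → Valid d₁ J₂ (minPerm d₁ d₂) →
      applyJ c₁ J₁ (minPerm c₁ c₂) ≢ applyJ d₁ J₂ (minPerm d₁ d₂))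
theorem21 s zero _ ()
theorem21 (suc s) (suc r) (s≤s r≤s) _ =
  (λ { _ _ (inj₁ (refl , refl)) J₁ J₂ j₁ j₂ size₁< size₂< _ _ → jumps-distinct (s≤s r≤s) J₁ J₂ j₁ j₂ size₁< size₂<
     ; _ _ (inj₂ (refl , refl)) J₁ J₂ j₁ j₂ size₁< size₂< _ _ → jumps-distinct ≤-refl J₁ J₂ j₁ j₂ size₁< size₂< })
  ,
  (λ { _ _ _ _ (inj₁ (refl , refl)) (inj₁ (refl , refl)) π₁≢π₂ → ⊥-elim (π₁≢π₂ refl)
     ; _ _ _ _ (inj₂ (refl , refl)) (inj₂ (refl , refl)) π₁≢π₂ → ⊥-elim (π₁≢π₂ refl)
     ; _ _ _ _ (inj₁ (refl , refl)) (inj₂ (refl , refl)) π₁≢π₂ J₁ J₂ j₁ j₂ size₁< size₂< _ _ →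
         minPerms-distinct ≤-refl (r<s π₁≢π₂) J₁ J₂ j₁ j₂ size₁< size₂<
     ; _ _ _ _ (inj₂ (refl , refl)) (inj₁ (refl , refl)) π₁≢π₂ J₁ J₂ j₁ j₂ size₁< size₂< _ _ →
         ≢-sym (minPerms-distinct ≤-refl (r<s (≢-sym π₁≢π₂)) J₂ J₁ j₂ j₁ size₂< size₁<) })
  where
  r<s : minPerm (suc s) (suc r) ≢ minPerm (suc r) (suc s) → r < s
  r<s π₁≢π₂ = ≤∧≢⇒< r≤s (λ { refl → π₁≢π₂ refl })
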